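{- Let $R$ be a regular shape, $N=|R|$, and $\tau\in SYT(R)$. Let $1\le k\le N-1$ be such that the cell of $\tau$ containing $k$ is $(i_1,j_1)$, the cell containing $k+1$ is $(i_2,j_2)$, and $i_1>i_2$, $j_1<j_2$. Then the tableau obtained from $\tau$ by exchanging the entries $k$ and $k+1$ belongs to $SYT(R)$.
   Context: Cells $(i,j)\in\mathbb{Z}^2$: row $i$ (numbered top to bottom), column $j$ (left to right); $\mathbb{N}^2=\{(i,j):i,j\ge1\}$. For finite $S\subseteq\mathbb{Z}^2$, $SYT(S)$ is the set of bijections $\tau:S\to\{1,\dots,|S|\}$ with $\tau(i,j)<\tau(i,j+1)$ and $\tau(i,j)<\tau(i+1,j)$ whenever the two cells involved lie in $S$. A finite set is connected if any two cells are joined by a path of cells in the set with consecutive cells differing by $(\pm1,0)$ or $(0,\pm1)$. A periodic shape is a finite $P\subseteq\mathbb{Z}^2$ containing $(1,1)$ which up to translation is a skew diagram $\lambda/\mu$ in French notation ($\lambda=(\lambda_1\ge\dots\ge\lambda_m)$, $\mu=(\mu_1\ge\dots\ge\mu_n)$, $n\ge m$, $k$-th row from the bottom occupying columns $\mu_k+1,\dots,\lambda_k$), which is connected and in which every column other than the left-most and right-most contains a cell $(i_0,j_0)$ with $(i_0,j_0\pm1)\in P$. A finite $N\subseteq\mathbb{N}^2$ is normal if it is connected and $N=\mathrm{conv}(N)\cap\mathbb{N}^2$ (convex hull in $\mathbb{R}^2$). A finite $R\subseteq\mathbb{N}^2$ is regular if $R=a+(P\cap N)$ for some $a\in\mathbb{Z}^2$,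 periodic shape $P$ and normal shape $N$ such that the bottom row of $N$ equals the bottom row of $P$. -}

module Defs where

open import Data.Nat as ℕ using (ℕ; zero; suc; _≡ᵇ_)
open import Data.Integer as ℤ using (ℤ; +_; -[1+_]; _+_; _-_; _*_; _≤_; _<_; -_)
open import Data.Product using (Σ; ∃; ∃-syntax; _×_; _,_; proj₁; proj₂)
open import Data.Sum using (_⊎_)
open import Data.List using (List; []; _∷_; length; foldr)
open import Data.List.Membership.Propositional using (_∈_)
open import Data.List.Relation.Unary.Unique.Propositional using (Unique)
open import Data.List.Relation.Unary.All using (All)
open import Data.Bool using (if_then_else_)
open import Relation.Binary.PropositionalEquality using (_≡_)
open import Function.Bundles using (_⇔_)

-- A cell (i , j): row i (numbered top to bottom), column j (left to right).
Cell : Set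
Cell = ℤ × ℤ

row : Cell → ℤ
row = proj₁

col : Cell → ℤ
col = proj₂

_⊕_ : Cell → Cell → Cell
(a , b) ⊕ (c , d) = (a + c , b + d)

CellSet : Set₁
CellSet = Cell → Set

InN² : Cell → Set
InN² (i , j) = (+ 1 ≤ i) × (+ 1 ≤ j)

-- Finite subsets are represented by lists (duplicate-free where cardinality matters).
⟦_⟧ : List Cell → CellSet
⟦ xs ⟧ c = c ∈ xs

Adjacent : Cell → Cell → Set
Adjacent (i , j) (i' , j') =
  ((i' ≡ i + + 1) × (j' ≡ j)) ⊎ ((i' ≡ i - + 1) × (j' ≡ j)) ⊎
  ((i' ≡ i) × (j' ≡ j + + 1)) ⊎ ((i' ≡ i) × (j' ≡ j - + 1))

-- A path of cells inside S from c to d (c is assumed in S; each step stays in S).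
data PathIn (S : CellSet) : Cell → Cell → Set where
  here : ∀ {c} → PathIn S c c
  step : ∀ {c c' d} → Adjacent c c' → S c' → PathIn S c' d → PathIn S c d

Connected : CellSet → Set
Connected S = ∀ c d → S c → S d → PathIn S c d

-- k-th part (1-indexed) of a list of naturals, 0 beyond its length.
part : List ℕ → ℕ → ℕ
part []       _             = 0
part (x ∷ xs) zero          = 0
part (x ∷ xs) (suc zero)    = x
part (x ∷ xs) (suc (suc k)) = part xs (suc k)

IsPartition : List ℕ → Set
IsPartition xs = ∀ k → 1 ℕ.≤ k → part xs (suc k) ℕ.≤ part xs k

IsSkew : List ℕ → List ℕ → Set
IsSkew lam mu = IsPartition lam × IsPartition mu ×
                (length lam ℕ.≤ length mu) × (∀ k → part mu k ℕ.≤ part lam k)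

-- the cells of λ/μ in French notation: the k-th row from the bottom (row index -k)
-- occupies the columns μₖ+1 , … , λₖ.
SkewCells : List ℕ → List ℕ → CellSet
SkewCells lam mu (i , j) =
  Σ ℕ λ k → (1 ℕ.≤ k) × (i ≡ - (+ k)) × (+ part mu k < j) × (j ≤ + part lam k)

Periodic : CellSet → Set
Periodic P =
  (Σ (List Cell) λ xs → ∀ c → P c ⇔ (c ∈ xs)) ×
  P (+ 1 , + 1) ×
  (Σ Cell λ b → Σ (List ℕ) λ lam → Σ (List ℕ) λ mu →
     IsSkew lam mu × (∀ c → P c ⇔ (Σ Cell λ d → SkewCells lam mu d × (c ≡ b ⊕ d)))) ×
  Connected P ×
  (∀ (j₀ : ℤ) → (Σ Cell λ c → P c × (col c < j₀)) → (Σ Cell λ c → P c × (j₀ < col c)) →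
     Σ ℤ λ i₀ → P (i₀ , j₀) × P (i₀ , j₀ - + 1) × P (i₀ , j₀ + + 1))

wsum : List (Cell × ℕ) → Cell
wsum = foldr (λ { ((i , j) , w) (a , b) → (+ w * i + a , + w * j + b) }) (+ 0 , + 0)

wtot : List (Cell × ℕ) → ℕ
wtot = foldr (λ qw t → proj₂ qw ℕ.+ t) 0

-- p lies in the convex hull of the finite set N of lattice points:
-- p = Σ (wₗ / W) qₗ with qₗ ∈ N, wₗ ∈ ℕ, W = Σ wₗ > 0 (rational convex combination).
InConv : List Cell → Cell → Set
InConv N (i , j) =
  Σ (List (Cell × ℕ)) λ ws → All (λ qw → proj₁ qw ∈ N) ws × (1 ℕ.≤ wtot ws) ×
    (wsum ws ≡ (+ wtot ws * i , + wtot ws * j))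

Normal : List Cell → Set
Normal N =
  All InN² N × Connected ⟦ N ⟧ × (∀ p → InN² p → InConv N p → p ∈ N)

BottomRow : CellSet → CellSet
BottomRow S c = S c × (∀ d → S d → row d ≤ row c)

Regular : List Cell → Set₁
Regular R =
  All InN² R ×
  Σ Cell λ a → Σ CellSet λ P → Σ (List Cell) λ N →
    Periodic P × Normal N ×
    (∀ c → BottomRow ⟦ N ⟧ c ⇔ BottomRow P c) ×
    (∀ c → (c ∈ R) ⇔ (Σ Cell λ d → P d × (d ∈ N) × (c ≡ a ⊕ d)))

SYT : List Cell → (Cell → ℕ) → Set
SYT S τ =
  (∀ c → c ∈ S → (1 ℕ.≤ τ c) × (τ c ℕ.≤ length S)) ×
  (∀ c d → c ∈ S → d ∈ S → τ c ≡ τ d → c ≡ d) ×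
  (∀ m → 1 ℕ.≤ m → m ℕ.≤ length S → Σ Cell λ c → (c ∈ S) × (τ c ≡ m)) ×
  (∀ i j → (i , j) ∈ S → (i , j + + 1) ∈ S → τ (i , j) ℕ.< τ (i , j + + 1)) ×
  (∀ i j → (i , j) ∈ S → (i + + 1 , j) ∈ S → τ (i , j) ℕ.< τ (i + + 1 , j))

swapEntries : ℕ → (Cell → ℕ) → Cell → ℕ
swapEntries k τ c =
  if τ c ≡ᵇ k then suc k else (if τ c ≡ᵇ suc k then k else τ c)

-- Exchanging k and k + 1 can only break monotonicity along a row or a column
-- between the two cells holding k and k + 1, so it suffices that these cells
-- lie in different rows and different columns. On entries the exchange is the transposition (k k+1), a bijection
-- of {1, …, |R|} that preserves < on every pair other than (k , k + 1).
module Submission where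

open import Defs
open import Data.Nat using (ℕ; suc; _≤_; _<_; _≡ᵇ_; s≤s; z≤n)
open import Data.Nat.Properties
  using (≡ᵇ⇒≡; ≡⇒≡ᵇ; <-irrefl; <-asym; <-trans; ≤∧≢⇒<; ≤-pred; n<1+n; n≤1+n; ≤-trans)
open import Data.Integer using (ℤ; _+_; +_) renaming (_<_ to _<ℤ_)
import Data.Integer.Properties as ℤ
open import Data.Product using (Σ; _×_; _,_)
open import Data.List using (List; length)
open import Data.List.Membership.Propositional using (_∈_)
open import Data.List.Relation.Unary.Unique.Propositional using (Unique)
open import Data.Bool using (true; false; T; if_then_else_)
open import Data.Unit using (tt)
open import Data.Empty using (⊥-elim)
open import Relation.Nullary using (¬_)
open import Function using (_∘_)
open import Relation.Binary.PropositionalEquality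
  using (_≡_; _≢_; refl; sym; trans; cong; subst; module ≡-Reasoning)

-- swapEntries k τ c unfolds definitionally to transpose k (τ c).
transpose : ℕ → ℕ → ℕ
transpose k n = if n ≡ᵇ k then suc k else (if n ≡ᵇ suc k then k else n)

data TransposeView (k : ℕ) : ℕ → ℕ → Set where
  at-k     : TransposeView k k (suc k)
  at-suc-k : TransposeView k (suc k) k
  fixed    : ∀ {n} → n ≢ k → n ≢ suc k → TransposeView k n n

transpose-view : ∀ k n → TransposeView k n (transpose k n)
transpose-view k n with n ≡ᵇ k in n≡ᵇk
... | true rewrite ≡ᵇ⇒≡ n k (subst T (sym n≡ᵇk) tt) = at-k
... | false with n ≡ᵇ suc k in n≡ᵇsk
...   | true rewrite ≡ᵇ⇒≡ n (suc k) (subst T (sym n≡ᵇsk) tt) = at-suc-k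
...   | false = fixed (λ n≡k → subst T n≡ᵇk (≡⇒≡ᵇ n k n≡k))
                      (λ n≡sk → subst T n≡ᵇsk (≡⇒≡ᵇ n (suc k) n≡sk))

TransposeView-sym : ∀ {k m n} → TransposeView k m n → TransposeView k n m
TransposeView-sym at-k            = at-suc-k
TransposeView-sym at-suc-k        = at-k
TransposeView-sym (fixed m≢k m≢sk) = fixed m≢k m≢sk

TransposeView-functional : ∀ {k m n n′} → TransposeView k m n → TransposeView k m n′ → n ≡ n′
TransposeView-functional at-k             at-k              = refl
TransposeView-functional at-k             (fixed k≢k _)     = ⊥-elim (k≢k refl)
TransposeView-functional at-suc-k         at-suc-k          = refl
TransposeView-functional at-suc-k         (fixed _ sk≢sk)   = ⊥-elim (sk≢sk refl)
TransposeView-functional (fixed k≢k _)    at-k              = ⊥-elim (k≢k refl)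
TransposeView-functional (fixed _ sk≢sk)  at-suc-k          = ⊥-elim (sk≢sk refl)
TransposeView-functional (fixed _ _)      (fixed _ _)       = refl

transpose-involutive : ∀ k n → transpose k (transpose k n) ≡ n
transpose-involutive k n =
  TransposeView-functional (transpose-view k (transpose k n))
                           (TransposeView-sym (transpose-view k n))

transpose-injective : ∀ k {m n} → transpose k m ≡ transpose k n → m ≡ n
transpose-injective k {m} {n} eq = begin
  m                             ≡⟨ sym (transpose-involutive k m) ⟩
  transpose k (transpose k m)   ≡⟨ cong (transpose k) eq ⟩
  transpose k (transpose k n)   ≡⟨ transpose-involutive k n ⟩
  n                             ∎
  where open ≡-Reasoning

transpose-preserves-range : ∀ {k L n} → 1 ≤ k → suc k ≤ L →
  1 ≤ n × n ≤ L → 1 ≤ transpose k n × transpose k n ≤ L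
transpose-preserves-range {k} {L} {n} 1≤k sk≤L n∈range
  with transpose k n | transpose-view k n
... | _ | at-k      = s≤s z≤n , sk≤L
... | _ | at-suc-k  = 1≤k , ≤-trans (n≤1+n k) sk≤L
... | _ | fixed _ _ = n∈range

transpose-mono-< : ∀ {k m n} → m < n → ¬ (m ≡ k × n ≡ suc k) →
  transpose k m < transpose k n
transpose-mono-< {k} {m} {n} m<n not-k,sk
  with transpose k m | transpose-view k m | transpose k n | transpose-view k n
... | _ | at-k              | _ | at-k             = ⊥-elim (<-irrefl refl m<n)
... | _ | at-k              | _ | at-suc-k         = ⊥-elim (not-k,sk (refl , refl))
... | _ | at-k              | _ | fixed _ n≢sk     = ≤∧≢⇒< m<n (λ sk≡n → n≢sk (sym sk≡n))
... | _ | at-suc-k          | _ | at-k             = ⊥-elim (<-asym m<n (n<1+n k))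
... | _ | at-suc-k          | _ | at-suc-k         = ⊥-elim (<-irrefl refl m<n)
... | _ | at-suc-k          | _ | fixed _ _        = <-trans (n<1+n k) m<n
... | _ | fixed _ _         | _ | at-k             = <-trans m<n (n<1+n k)
... | _ | fixed m≢k _       | _ | at-suc-k         = ≤∧≢⇒< (≤-pred m<n) m≢k
... | _ | fixed _ _         | _ | fixed _ _        = m<n

SYT-swapEntries : ∀ {S τ k c₁ c₂} → SYT S τ → 1 ≤ k → suc k ≤ length S →
  c₁ ∈ S → τ c₁ ≡ k → c₂ ∈ S → τ c₂ ≡ suc k →
  row c₁ ≢ row c₂ → col c₁ ≢ col c₂ → SYT S (swapEntries k τ)
SYT-swapEntries {S} {τ} {k} {c₁} {c₂} (range , injective , onto , row-< , col-<)
  1≤k sk≤|S| c₁∈S τc₁≡k c₂∈S τc₂≡sk rows≢ cols≢ =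
  range′ , injective′ , onto′ , row-<′ , col-<′
  where
  holder-of-k : ∀ {c} → c ∈ S → τ c ≡ k → c ≡ c₁
  holder-of-k c∈S τc≡k = injective _ _ c∈S c₁∈S (trans τc≡k (sym τc₁≡k))

  holder-of-suc-k : ∀ {c} → c ∈ S → τ c ≡ suc k → c ≡ c₂
  holder-of-suc-k c∈S τc≡sk = injective _ _ c∈S c₂∈S (trans τc≡sk (sym τc₂≡sk))

  range′ : ∀ c → c ∈ S → 1 ≤ transpose k (τ c) × transpose k (τ c) ≤ length S
  range′ c c∈S = transpose-preserves-range 1≤k sk≤|S| (range c c∈S)

  injective′ : ∀ c d → c ∈ S → d ∈ S → transpose k (τ c) ≡ transpose k (τ d) → c ≡ d
  injective′ c d c∈S d∈S eq = injective c d c∈S d∈S (transpose-injective k eq)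

  onto′ : ∀ m → 1 ≤ m → m ≤ length S → Σ Cell λ c → c ∈ S × transpose k (τ c) ≡ m
  onto′ m 1≤m m≤|S| with transpose-preserves-range 1≤k sk≤|S| (1≤m , m≤|S|)
  ... | 1≤m′ , m′≤|S| with onto (transpose k m) 1≤m′ m′≤|S|
  ...   | c , c∈S , τc≡m′ = c , c∈S , trans (cong (transpose k) τc≡m′) (transpose-involutive k m)

  row-<′ : ∀ i j → (i , j) ∈ S → (i , j + + 1) ∈ S →
    transpose k (τ (i , j)) < transpose k (τ (i , j + + 1))
  row-<′ i j c∈S d∈S = transpose-mono-< (row-< i j c∈S d∈S) λ (τc≡k , τd≡sk) →
    rows≢ (trans (sym (cong row (holder-of-k c∈S τc≡k))) (cong row (holder-of-suc-k d∈S τd≡sk)))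

  col-<′ : ∀ i j → (i , j) ∈ S → (i + + 1 , j) ∈ S →
    transpose k (τ (i , j)) < transpose k (τ (i + + 1 , j))
  col-<′ i j c∈S d∈S = transpose-mono-< (col-< i j c∈S d∈S) λ (τc≡k , τd≡sk) →
    cols≢ (trans (sym (cong col (holder-of-k c∈S τc≡k))) (cong col (holder-of-suc-k d∈S τd≡sk)))

proposition1 : (R : List Cell) → Unique R → Regular R →
    (τ : Cell → ℕ) → SYT R τ →
    (k : ℕ) → 1 ≤ k → suc k ≤ length R →
    (i₁ j₁ i₂ j₂ : ℤ) →
    (i₁ , j₁) ∈ R → τ (i₁ , j₁) ≡ k →
    (i₂ , j₂) ∈ R → τ (i₂ , j₂) ≡ suc k →
    i₂ <ℤ i₁ → j₁ <ℤ j₂ →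
    SYT R (swapEntries k τ)
proposition1 R _ _ τ τ-SYT k 1≤k sk≤|R| i₁ j₁ i₂ j₂ c₁∈R τc₁≡k c₂∈R τc₂≡sk i₂<i₁ j₁<j₂ =
  SYT-swapEntries τ-SYT 1≤k sk≤|R| c₁∈R τc₁≡k c₂∈R τc₂≡sk
    (ℤ.<⇒≢ i₂<i₁ ∘ sym) (ℤ.<⇒≢ j₁<j₂)
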